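{- Consider a run of the simplex method with the highest-gain pivoting rule on a deterministic MDP with $n$ states and per-action discounts in $[0,1)$. Suppose the method moves from policy $\pi$ to policy $\pi'$ by changing the action used at state $s$, and this creates a new cycle $C$ of $\pi'$ that is dominated by $\gamma_a$ for some action $a$ of $\pi'$. Let $\pi''$ be the last policy of the run in which $s$ lies on a cycle dominated by $\gamma_a$. Then $$v^{\pi''}_s-v^{\pi'}_s\le\left(1-\frac1{n^2}\right)\left(v^{\pi''}_s-v^{\pi}_s\right).$$
   Context: A deterministic MDP has $n$ states $S$ and finitely many actions $A$; action $b$ is performable in state $s(b)$, has reward $r_b\in\mathbb{R}$, discount $\gamma_b\in[0,1)$, and leads deterministically to state $t(b)$; each state has at least one action. A policy $\pi$ picks one action $\pi(s)$ with $s(\pi(s))=s$ per state. Values: $v^\pi$ is the unique solution of $v^\pi_u=r_{\pi(u)}+\gamma_{\pi(u)}v^\pi_{t(\pi(u))}$ for all $u$. Gains: $r^\pi_b=r_b+\gamma_b v^\pi_{t(b)}-v^\pi_{s(b)}$. The functional graph of $\pi$ has edges $u\to t(\pi(u))$; its directed cycles (identified with their action sets) are the cycles of $\pi$. A cycle $C$ is dominated by $\gamma_a$ if $\min_{b\in C}\gamma_b=\gamma_a$. The simplex method with highest-gain pivoting: start from any policy; while some gain is positive, choose $b$ maximizing $r^\pi_b$ (ties arbitrary) and replace $\pi(s(b))$ by $b$; stop when all gains are $\le0$. A pivot from $\pi$ to $\pi'$ creates a new cycle if $\pi'$ has a cycle that is not a cycle of $\pi$. -}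

module Defs where

open import Level using (0ℓ)
open import Data.Nat using (ℕ; zero; suc) renaming (_<_ to _<ℕ_; _≤_ to _≤ℕ_)
open import Data.Fin using (Fin)
open import Data.Fin.Subset using (Subset; _∈_)
open import Data.Product using (Σ; ∃; _×_; _,_)
open import Relation.Nullary using (¬_)
open import Relation.Binary.PropositionalEquality using (_≡_)
open import Relation.Binary.Structures using (IsTotalOrder)
open import Algebra.Structures using (IsCommutativeRing)
open import Function.Bundles using (_⇔_)

-- Ordered fields (stdlib has no reals; we work over an arbitrary ordered
-- field, of which ℝ is an instance).  Inverse is total with the
-- convention 0⁻¹ = 0; only x ≢ 0 inverses are constrained.

record OrderedField : Set₁ where
  infixl 6 _+_ _-_
  infixl 7 _*_
  infix  4 _≤_ _<_
  field
    Carrier : Set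
    _+_ _*_ : Carrier → Carrier → Carrier
    -_      : Carrier → Carrier
    0# 1#   : Carrier
    _⁻¹     : Carrier → Carrier
    _≤_     : Carrier → Carrier → Set
    isCommutativeRing : IsCommutativeRing _≡_ _+_ _*_ -_ 0# 1#
    0≢1     : ¬ (0# ≡ 1#)
    ⁻¹-inverse : ∀ x → ¬ (x ≡ 0#) → x * (x ⁻¹) ≡ 1#
    isTotalOrder : IsTotalOrder _≡_ _≤_
    +-mono-≤ : ∀ x y z → x ≤ y → x + z ≤ y + z
    *-nonneg : ∀ x y → 0# ≤ x → 0# ≤ y → 0# ≤ x * y

  _-_ : Carrier → Carrier → Carrier
  x - y = x + (- y)

  _<_ : Carrier → Carrier → Set
  x < y = x ≤ y × ¬ (x ≡ y)

  fromℕ : ℕ → Carrier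
  fromℕ zero    = 0#
  fromℕ (suc k) = 1# + fromℕ k

module _ (F : OrderedField) where
  open OrderedField F

  record DMDP (n : ℕ) : Set where
    field
      m     : ℕ
      src   : Fin m → Fin n
      tgt   : Fin m → Fin n
      r     : Fin m → Carrier
      γ     : Fin m → Carrier
      γ-range  : ∀ b → (0# ≤ γ b) × (γ b < 1#)
      nonempty : ∀ (u : Fin n) → ∃ λ b → src b ≡ u

  module MDPNotions {n : ℕ} (M : DMDP n) where
    open DMDP M

    IsPolicy : (Fin n → Fin m) → Set
    IsPolicy π = ∀ u → src (π u) ≡ u

    IsValue : (Fin n → Fin m) → (Fin n → Carrier) → Set
    IsValue π v = ∀ u → v u ≡ r (π u) + γ (π u) * v (tgt (π u))

    gain : (Fin n → Carrier) → Fin m → Carrier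
    gain v b = r b + γ b * v (tgt b) - v (src b)

    iter : (Fin n → Fin m) → ℕ → Fin n → Fin n
    iter π zero    u = u
    iter π (suc k) u = iter π k (tgt (π u))

    IsCycle : (Fin n → Fin m) → Subset m → Set
    IsCycle π C = Σ (Fin n) λ u →
      (∃ λ k → iter π (suc k) u ≡ u) ×
      (∀ b → (b ∈ C) ⇔ (∃ λ i → b ≡ π (iter π i u)))

    DominatedBy : Subset m → Fin m → Set
    DominatedBy C a = (∃ λ b → b ∈ C × γ b ≡ γ a) × (∀ b → b ∈ C → γ a ≤ γ b)

    IsActionOf : (Fin n → Fin m) → Fin m → Set
    IsActionOf π a = ∃ λ u → π u ≡ a

    OnDominatedCycle : (Fin n → Fin m) → Fin n → Fin m → Set
    OnDominatedCycle π s a = Σ (Subset m) λ C' → IsCycle π C' × π s ∈ C' × DominatedBy C' a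

    Pivot : (Fin n → Fin m) → Fin m → (Fin n → Fin m) → Set
    Pivot π b π' = (π' (src b) ≡ b) × (∀ u → ¬ (u ≡ src b) → π' u ≡ π u)

    record HGRun : Set where
      field
        K      : ℕ
        pol    : ℕ → Fin n → Fin m
        val    : ℕ → Fin n → Carrier
        piv    : ℕ → Fin m
        pol-ok : ∀ k → IsPolicy (pol k)
        val-ok : ∀ k → IsValue (pol k) (val k)
        piv-pos : ∀ k → k <ℕ K → 0# < gain (val k) (piv k)
        piv-max : ∀ k → k <ℕ K → ∀ b → gain (val k) b ≤ gain (val k) (piv k)
        piv-upd : ∀ k → k <ℕ K → Pivot (pol k) (piv k) (pol (suc k))
        stop    : ∀ b → gain (val K) b ≤ 0#

module Submission where

-- Let b = piv i be the entering action, s = s(b), Δ > 0 its gain, c = γ_a, and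
-- measure values relative to v = val i: y = v′(s) - v(s) for π′ = pol (i + 1) and
-- x = v″(s) - v(s) for π″ = pol j.  For any policy σ the difference vσ - v obeys
-- d(w) = gain_v(σ w) + γ(σ w) d(t(σ w)); unrolling it around cycles gives:
--  (1) the new cycle must contain b (else it was a cycle before the pivot), so it
--      runs through s, where all gains but Δ vanish: y = Δ + Q y with Q the product
--      of discounts around it, cᵠ ≤ Q ≤ 1, q ≤ n; Bernoulli gives Δ ≤ n (1 - c) y;
--  (2) around the dominated cycle of π″ through s every gain is ≤ Δ (highest gain)
--      and the discount product is ≤ c, so (1 - c) x ≤ n Δ when x ≥ 0;
--  (3) hence x ≤ n² y, which is the claim x - y ≤ (1 - 1/n²) x.

open import Defs
open import Level using (0ℓ)
open import Data.Nat as ℕ using (ℕ; zero; suc; _∸_; s≤s; z≤n; NonZero)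
  renaming (_*_ to _*ℕ_; _<_ to _<ℕ_; _≤_ to _≤ℕ_)
import Data.Nat.Properties as ℕₚ
open import Data.Nat.DivMod using (_%_; _/_; m≡m%n+[m/n]*n; m%n<n)
open import Data.Nat.Induction using (<-wellFounded)
open import Induction.WellFounded using (Acc; acc)
open import Data.Fin as Fin using (Fin; toℕ; fromℕ<)
open import Data.Fin.Properties using (any?; pigeonhole; toℕ<n; toℕ-fromℕ<; _≟_)
open import Data.Fin.Subset using (Subset; _∈_)
open import Data.Fin.Subset.Properties using (_∈?_)
open import Data.Product using (∃; ∃₂; _,_; proj₁; proj₂) renaming (_×_ to _×ₚ_)
open import Data.Sum using (inj₁; inj₂)
open import Data.Empty using (⊥; ⊥-elim)
open import Data.Maybe using (Maybe; just; nothing)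
open import Function.Bundles using (_⇔_; Equivalence; mk⇔)
open import Relation.Nullary using (¬_; yes; no)
open import Relation.Binary.Structures using (IsTotalOrder)
open import Relation.Binary.Bundles using (Poset)
import Relation.Binary.Reasoning.PartialOrder
open import Relation.Binary.PropositionalEquality
open import Algebra.Bundles using (CommutativeRing; RawRing; Semiring)
import Algebra.Solver.Ring
open import Algebra.Solver.Ring.AlmostCommutativeRing
  using (fromCommutativeRing; _-Raw-AlmostCommutative⟶_)

module FieldSolver (F : OrderedField) where
  open OrderedField F

  commutativeRing : CommutativeRing 0ℓ 0ℓ
  commutativeRing = record { isCommutativeRing = isCommutativeRing }

  open CommutativeRing commutativeRing
    using (+-identityˡ; +-identityʳ; -‿inverseʳ; +-abelianGroup; +-commutativeSemigroup; ring; semiring)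
  open import Algebra.Properties.AbelianGroup +-abelianGroup
    using (⁻¹-∙-comm; ⁻¹-anti-homo‿-)
  open import Algebra.Properties.CommutativeSemigroup +-commutativeSemigroup
    using (interchange)
  open import Algebra.Properties.Ring ring using ([y-z]x≈yx-zx; x[y-z]≈xy-xz; -0#≈0#)
  open import Algebra.Properties.Semiring.Mult.TCOptimised semiring using (_×_; 1+×; ×-homo-+; ×1-homo-*)

  difference-of-sums : ∀ a b c d → (a + c) - (b + d) ≡ (a - b) + (c - d)
  difference-of-sums a b c d = begin
    (a + c) + - (b + d)    ≡⟨ cong ((a + c) +_) (sym (⁻¹-∙-comm b d)) ⟩
    (a + c) + (- b + - d)  ≡⟨ interchange a c (- b) (- d) ⟩
    (a - b) + (c - d)      ∎
    where open ≡-Reasoning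

  difference-of-differences : ∀ a b c d → (a - b) - (c - d) ≡ (a + d) - (b + c)
  difference-of-differences a b c d = begin
    (a - b) + - (c - d)    ≡⟨ cong ((a - b) +_) (⁻¹-anti-homo‿- c d) ⟩
    (a + - b) + (d + - c)  ≡⟨ interchange a (- b) d (- c) ⟩
    (a + d) + (- b + - c)  ≡⟨ cong ((a + d) +_) (⁻¹-∙-comm b c) ⟩
    (a + d) - (b + c)      ∎
    where open ≡-Reasoning

  -- ι k is the image of k in the field, computed so that ι 0 = 0# and ι 1 = 1#
  -- hold definitionally (the solver's constants 0 and 1 must be the field's).
  ι : ℕ → Carrier
  ι k = k × 1#

  ι-+ : ∀ p q → ι (p ℕ.+ q) ≡ ι p + ι q
  ι-+ p q = ×-homo-+ 1# p q

  ι-* : ∀ p q → ι (p ℕ.* q) ≡ ι p * ι q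
  ι-* = ×1-homo-*

  fromℕ≡ι : ∀ k → fromℕ k ≡ ι k
  fromℕ≡ι zero    = refl
  fromℕ≡ι (suc k) = trans (cong (1# +_) (fromℕ≡ι k)) (sym (1+× k 1#))

  -- Integer coefficients for the ring solver, as pairs (p , q) denoting p - q.
  -- Results of operations are normalised (one component zero), so that equal
  -- integers are syntactically equal; this is what lets the solver decide
  -- coefficient equality.
  ℤ₂ : Set
  ℤ₂ = ℕ ×ₚ ℕ

  normalise : ℕ → ℕ → ℤ₂
  normalise p q = (p ∸ q , q ∸ p)

  ⟦_⟧ᶻ : ℤ₂ → Carrier
  ⟦ p , zero  ⟧ᶻ = ι p
  ⟦ p , suc q ⟧ᶻ = ι p - ι (suc q)

  ⟦⟧ᶻ-sound : ∀ p q → ⟦ p , q ⟧ᶻ ≡ ι p - ι q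
  ⟦⟧ᶻ-sound p zero    = sym (trans (cong (ι p +_) -0#≈0#) (+-identityʳ (ι p)))
  ⟦⟧ᶻ-sound p (suc q) = refl

  ∸-difference : ∀ p q → ι (p ∸ q) - ι (q ∸ p) ≡ ι p - ι q
  ∸-difference zero    zero    = refl
  ∸-difference zero    (suc q) = refl
  ∸-difference (suc p) zero    = refl
  ∸-difference (suc p) (suc q) = begin
    ι (p ∸ q) - ι (q ∸ p)             ≡⟨ ∸-difference p q ⟩
    ι p - ι q                         ≡⟨ sym (+-identityˡ _) ⟩
    0# + (ι p - ι q)                  ≡⟨ cong (_+ (ι p - ι q)) (sym (-‿inverseʳ 1#)) ⟩
    (1# - 1#) + (ι p - ι q)           ≡⟨ sym (difference-of-sums 1# 1# (ι p) (ι q)) ⟩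
    (1# + ι p) - (1# + ι q)           ≡⟨ sym (cong₂ _-_ (1+× p 1#) (1+× q 1#)) ⟩
    ι (suc p) - ι (suc q)             ∎
    where open ≡-Reasoning

  normalise-sound : ∀ p q → ⟦ normalise p q ⟧ᶻ ≡ ι p - ι q
  normalise-sound p q = trans (⟦⟧ᶻ-sound (p ∸ q) (q ∸ p)) (∸-difference p q)

  ℤ₂-rawRing : RawRing 0ℓ 0ℓ
  ℤ₂-rawRing = record
    { Carrier = ℤ₂
    ; _≈_     = _≡_
    ; _+_     = λ (p , q) (p′ , q′) → normalise (p ℕ.+ p′) (q ℕ.+ q′)
    ; _*_     = λ (p , q) (p′ , q′) →
                  normalise (p ℕ.* p′ ℕ.+ q ℕ.* q′) (p ℕ.* q′ ℕ.+ q ℕ.* p′)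
    ; -_      = λ (p , q) → (q , p)
    ; 0#      = (0 , 0)
    ; 1#      = (1 , 0)
    }

  ℤ₂-morphism : ℤ₂-rawRing -Raw-AlmostCommutative⟶ fromCommutativeRing commutativeRing
  ℤ₂-morphism = record
    { ⟦_⟧    = ⟦_⟧ᶻ
    ; +-homo = λ (p , q) (p′ , q′) → begin
        ⟦ normalise (p ℕ.+ p′) (q ℕ.+ q′) ⟧ᶻ  ≡⟨ normalise-sound (p ℕ.+ p′) (q ℕ.+ q′) ⟩
        ι (p ℕ.+ p′) - ι (q ℕ.+ q′)          ≡⟨ cong₂ _-_ (ι-+ p p′) (ι-+ q q′) ⟩
        (ι p + ι p′) - (ι q + ι q′)          ≡⟨ difference-of-sums _ _ _ _ ⟩
        (ι p - ι q) + (ι p′ - ι q′)          ≡⟨ sym (cong₂ _+_ (⟦⟧ᶻ-sound p q) (⟦⟧ᶻ-sound p′ q′)) ⟩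
        ⟦ p , q ⟧ᶻ + ⟦ p′ , q′ ⟧ᶻ            ∎
    ; *-homo = λ (p , q) (p′ , q′) → let a = ι p; b = ι q; c = ι p′; d = ι q′ in begin
        ⟦ normalise (p ℕ.* p′ ℕ.+ q ℕ.* q′) (p ℕ.* q′ ℕ.+ q ℕ.* p′) ⟧ᶻ
          ≡⟨ normalise-sound (p ℕ.* p′ ℕ.+ q ℕ.* q′) (p ℕ.* q′ ℕ.+ q ℕ.* p′) ⟩
        ι (p ℕ.* p′ ℕ.+ q ℕ.* q′) - ι (p ℕ.* q′ ℕ.+ q ℕ.* p′)
          ≡⟨ cong₂ _-_ (trans (ι-+ (p ℕ.* p′) (q ℕ.* q′)) (cong₂ _+_ (ι-* p p′) (ι-* q q′)))
                       (trans (ι-+ (p ℕ.* q′) (q ℕ.* p′)) (cong₂ _+_ (ι-* p q′) (ι-* q p′))) ⟩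
        (a * c + b * d) - (a * d + b * c)   ≡⟨ sym (difference-of-differences (a * c) (a * d) (b * c) (b * d)) ⟩
        (a * c - a * d) - (b * c - b * d)   ≡⟨ sym (cong₂ _-_ (x[y-z]≈xy-xz a c d) (x[y-z]≈xy-xz b c d)) ⟩
        a * (c - d) - b * (c - d)           ≡⟨ sym ([y-z]x≈yx-zx (c - d) a b) ⟩
        (a - b) * (c - d)                   ≡⟨ sym (cong₂ _*_ (⟦⟧ᶻ-sound p q) (⟦⟧ᶻ-sound p′ q′)) ⟩
        ⟦ p , q ⟧ᶻ * ⟦ p′ , q′ ⟧ᶻ           ∎
    ; -‿homo = λ (p , q) → trans (⟦⟧ᶻ-sound q p)
                 (sym (trans (cong -_ (⟦⟧ᶻ-sound p q)) (⁻¹-anti-homo‿- (ι p) (ι q))))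
    ; 0-homo = refl
    ; 1-homo = refl
    }
    where open ≡-Reasoning

  ℤ₂-equal? : ∀ x y → Maybe (⟦ x ⟧ᶻ ≡ ⟦ y ⟧ᶻ)
  ℤ₂-equal? (p , q) (p′ , q′) with p ℕ.≟ p′ | q ℕ.≟ q′
  ... | yes refl | yes refl = just refl
  ... | _        | _        = nothing

  open Algebra.Solver.Ring ℤ₂-rawRing (fromCommutativeRing commutativeRing) ℤ₂-morphism ℤ₂-equal? public
    using (solve; _:=_; _:+_; _:*_; _:-_; :-_; con; Polynomial)

  :0 :1 : ∀ {k} → Polynomial k
  :0 = con (0 , 0)
  :1 = con (1 , 0)

module OrderedFieldProperties (F : OrderedField) where
  open OrderedField F
  open FieldSolver F
  open IsTotalOrder isTotalOrder public using (antisym; total) renaming (refl to ≤-refl; trans to ≤-trans)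
  open CommutativeRing commutativeRing using (+-comm; *-comm; *-assoc; *-identityˡ; *-identityʳ; zeroʳ)
  open import Algebra.Definitions.RawSemiring (Semiring.rawSemiring (CommutativeRing.semiring commutativeRing)) public using (_^_)

  ≤-poset : Poset 0ℓ 0ℓ 0ℓ
  ≤-poset = record { isPartialOrder = IsTotalOrder.isPartialOrder isTotalOrder }

  module ≤-Reasoning = Relation.Binary.Reasoning.PartialOrder ≤-poset

  ≤-respect : ∀ {x y x′ y′} → x ≡ x′ → y ≡ y′ → x ≤ y → x′ ≤ y′
  ≤-respect refl refl x≤y = x≤y

  ≤-reflexive : ∀ {x y} → x ≡ y → x ≤ y
  ≤-reflexive refl = ≤-refl

  difference-nonneg : ∀ {x y} → x ≤ y → 0# ≤ y - x
  difference-nonneg {x} {y} x≤y =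
    ≤-respect (solve 1 (λ x → x :- x := :0) refl x) refl (+-mono-≤ x y (- x) x≤y)

  nonneg-difference : ∀ {x y} → 0# ≤ y - x → x ≤ y
  nonneg-difference {x} {y} 0≤y-x =
    ≤-respect (solve 1 (λ x → :0 :+ x := x) refl x) (solve 2 (λ x y → y :- x :+ x := y) refl x y)
      (+-mono-≤ 0# (y - x) x 0≤y-x)

  ≤-by-difference : ∀ {x y} z → z ≡ y - x → 0# ≤ z → x ≤ y
  ≤-by-difference z refl = nonneg-difference

  +-monoʳ-≤ : ∀ z {x y} → x ≤ y → z + x ≤ z + y
  +-monoʳ-≤ z {x} {y} x≤y = ≤-respect (+-comm x z) (+-comm y z) (+-mono-≤ x y z x≤y)

  +-mono₂-≤ : ∀ {a b c d} → a ≤ b → c ≤ d → a + c ≤ b + d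
  +-mono₂-≤ {a} {b} {c} {d} a≤b c≤d = ≤-trans (+-mono-≤ a b c a≤b) (+-monoʳ-≤ b c≤d)

  +-nonneg : ∀ {a b} → 0# ≤ a → 0# ≤ b → 0# ≤ a + b
  +-nonneg 0≤a 0≤b = ≤-respect (solve 0 (:0 :+ :0 := :0) refl) refl (+-mono₂-≤ 0≤a 0≤b)

  neg-antitone : ∀ {x y} → x ≤ y → - y ≤ - x
  neg-antitone {x} {y} x≤y =
    ≤-by-difference (y - x) (solve 2 (λ x y → y :- x := :- x :- (:- y)) refl x y) (difference-nonneg x≤y)

  *-monoˡ-≤ : ∀ c {x y} → 0# ≤ c → x ≤ y → c * x ≤ c * y
  *-monoˡ-≤ c {x} {y} 0≤c x≤y =
    ≤-by-difference (c * (y - x)) (solve 3 (λ c x y → c :* (y :- x) := c :* y :- c :* x) refl c x y)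
      (*-nonneg c (y - x) 0≤c (difference-nonneg x≤y))

  *-monoʳ-≤ : ∀ c {x y} → 0# ≤ c → x ≤ y → x * c ≤ y * c
  *-monoʳ-≤ c {x} {y} 0≤c x≤y = ≤-respect (*-comm c x) (*-comm c y) (*-monoˡ-≤ c 0≤c x≤y)

  *-nonneg-nonpos : ∀ {a b} → 0# ≤ a → b ≤ 0# → a * b ≤ 0#
  *-nonneg-nonpos {a} 0≤a b≤0 = ≤-respect refl (zeroʳ a) (*-monoˡ-≤ a 0≤a b≤0)

  -- Squares are nonnegative, so 1 = (-1)² is positive.
  0≤1 : 0# ≤ 1#
  0≤1 with total 0# 1#
  ... | inj₁ 0≤1 = 0≤1
  ... | inj₂ 1≤0 = ≤-respect refl (solve 0 (:- :1 :* :- :1 := :1) refl) (*-nonneg (- 1#) (- 1#) 0≤-1 0≤-1)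
    where
      0≤-1 : 0# ≤ - 1#
      0≤-1 = ≤-respect refl (solve 0 (:0 :- :1 := :- :1) refl) (difference-nonneg 1≤0)

  1≰0 : ¬ (1# ≤ 0#)
  1≰0 1≤0 = 0≢1 (antisym 0≤1 1≤0)

  *-cancel-zero : ∀ {a b} → ¬ (a ≡ 0#) → a * b ≡ 0# → b ≡ 0#
  *-cancel-zero {a} {b} a≢0 ab≡0 = begin
    b                ≡⟨ solve 1 (λ b → b := :1 :* b) refl b ⟩
    1# * b           ≡⟨ cong (_* b) (sym (trans (*-comm (a ⁻¹) a) (⁻¹-inverse a a≢0))) ⟩
    a ⁻¹ * a * b     ≡⟨ *-assoc (a ⁻¹) a b ⟩
    a ⁻¹ * (a * b)   ≡⟨ cong (a ⁻¹ *_) ab≡0 ⟩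
    a ⁻¹ * 0#        ≡⟨ zeroʳ (a ⁻¹) ⟩
    0#               ∎
    where open ≡-Reasoning

  *-cancelˡ-nonneg : ∀ {a z} → 0# < a → 0# ≤ a * z → 0# ≤ z
  *-cancelˡ-nonneg {a} {z} (0≤a , 0≢a) 0≤az with total 0# z
  ... | inj₁ 0≤z = 0≤z
  ... | inj₂ z≤0 = ≤-reflexive (sym (*-cancel-zero (λ a≡0 → 0≢a (sym a≡0))
                     (antisym (*-nonneg-nonpos 0≤a z≤0) 0≤az)))

  ⁻¹-nonneg : ∀ {x} → 0# ≤ x → ¬ (x ≡ 0#) → 0# ≤ x ⁻¹
  ⁻¹-nonneg {x} 0≤x x≢0 with total 0# (x ⁻¹)
  ... | inj₁ 0≤x⁻¹ = 0≤x⁻¹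
  ... | inj₂ x⁻¹≤0 = ⊥-elim (1≰0 (≤-respect (⁻¹-inverse x x≢0) refl (*-nonneg-nonpos 0≤x x⁻¹≤0)))

  fromℕ-nonneg : ∀ k → 0# ≤ fromℕ k
  fromℕ-nonneg zero    = ≤-refl
  fromℕ-nonneg (suc k) = +-nonneg 0≤1 (fromℕ-nonneg k)

  fromℕ-suc-nonzero : ∀ k → ¬ (fromℕ (suc k) ≡ 0#)
  fromℕ-suc-nonzero k 1+k≡0 = 1≰0 (begin
    1#                 ≡⟨ solve 0 (:1 := :1 :+ :0) refl ⟩
    1# + 0#            ≤⟨ +-monoʳ-≤ 1# (fromℕ-nonneg k) ⟩
    fromℕ (suc k)      ≡⟨ 1+k≡0 ⟩
    0#                 ∎)
    where open ≤-Reasoning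

  fromℕ-+ : ∀ p q → fromℕ (p ℕ.+ q) ≡ fromℕ p + fromℕ q
  fromℕ-+ p q = begin
    fromℕ (p ℕ.+ q)    ≡⟨ fromℕ≡ι (p ℕ.+ q) ⟩
    ι (p ℕ.+ q)        ≡⟨ ι-+ p q ⟩
    ι p + ι q          ≡⟨ sym (cong₂ _+_ (fromℕ≡ι p) (fromℕ≡ι q)) ⟩
    fromℕ p + fromℕ q  ∎
    where open ≡-Reasoning

  fromℕ-* : ∀ p q → fromℕ (p ℕ.* q) ≡ fromℕ p * fromℕ q
  fromℕ-* p q = begin
    fromℕ (p ℕ.* q)    ≡⟨ fromℕ≡ι (p ℕ.* q) ⟩
    ι (p ℕ.* q)        ≡⟨ ι-* p q ⟩
    ι p * ι q          ≡⟨ sym (cong₂ _*_ (fromℕ≡ι p) (fromℕ≡ι q)) ⟩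
    fromℕ p * fromℕ q  ∎
    where open ≡-Reasoning

  fromℕ-mono : ∀ {p q} → p ℕ.≤ q → fromℕ p ≤ fromℕ q
  fromℕ-mono {p} {q} p≤q = ≤-by-difference (fromℕ (q ∸ p)) difference (fromℕ-nonneg (q ∸ p))
    where
      difference : fromℕ (q ∸ p) ≡ fromℕ q - fromℕ p
      difference = begin
        fromℕ (q ∸ p)                      ≡⟨ solve 2 (λ x y → x := (y :+ x) :- y) refl (fromℕ (q ∸ p)) (fromℕ p) ⟩
        (fromℕ p + fromℕ (q ∸ p)) - fromℕ p ≡⟨ cong (_- fromℕ p) (sym (fromℕ-+ p (q ∸ p))) ⟩
        fromℕ (p ℕ.+ (q ∸ p)) - fromℕ p     ≡⟨ cong (λ k → fromℕ k - fromℕ p) (ℕₚ.m+[n∸m]≡n p≤q) ⟩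
        fromℕ q - fromℕ p                   ∎
        where open ≡-Reasoning

  ^-unit-interval : ∀ {c} → 0# ≤ c → c ≤ 1# → ∀ p → 0# ≤ c ^ p ×ₚ c ^ p ≤ 1#
  ^-unit-interval 0≤c c≤1 zero    = 0≤1 , ≤-refl
  ^-unit-interval {c} 0≤c c≤1 (suc p) with ^-unit-interval 0≤c c≤1 p
  ... | 0≤cᵖ , cᵖ≤1 = *-nonneg c (c ^ p) 0≤c 0≤cᵖ
                    , ≤-trans (*-monoˡ-≤ c 0≤c cᵖ≤1) (≤-respect (sym (*-identityʳ c)) refl c≤1)

  bernoulli : ∀ {c} → 0# ≤ c → c ≤ 1# → ∀ p → 1# - c ^ p ≤ fromℕ p * (1# - c)
  bernoulli {c} 0≤c c≤1 zero =
    ≤-reflexive (solve 1 (λ c → :1 :- :1 := :0 :* (:1 :- c)) refl c)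
  bernoulli {c} 0≤c c≤1 (suc p) =
    ≤-respect (solve 2 (λ c w → (:1 :- w) :+ w :* (:1 :- c) := :1 :- c :* w) refl c (c ^ p))
              (solve 2 (λ c k → k :* (:1 :- c) :+ (:1 :- c) := (:1 :+ k) :* (:1 :- c)) refl c (fromℕ p))
      (+-mono₂-≤ (bernoulli 0≤c c≤1 p)
        (≤-respect refl (*-identityˡ (1# - c))
          (*-monoʳ-≤ (1# - c) (difference-nonneg c≤1) (proj₂ (^-unit-interval 0≤c c≤1 p)))))

module FunctionalGraph (F : OrderedField) {n : ℕ} (M : DMDP F n) where
  open DMDP M
  open MDPNotions F M

  Policy : Set
  Policy = Fin n → Fin m

  iter-+ : ∀ σ p q w → iter σ (p ℕ.+ q) w ≡ iter σ q (iter σ p w)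
  iter-+ σ zero    q w = refl
  iter-+ σ (suc p) q w = iter-+ σ p q (tgt (σ w))

  iter-multiple : ∀ σ {P w} → iter σ P w ≡ w → ∀ k → iter σ (k ℕ.* P) w ≡ w
  iter-multiple σ         ret zero    = refl
  iter-multiple σ {P} {w} ret (suc k) = begin
    iter σ (P ℕ.+ k ℕ.* P) w       ≡⟨ iter-+ σ P (k ℕ.* P) w ⟩
    iter σ (k ℕ.* P) (iter σ P w)  ≡⟨ cong (iter σ (k ℕ.* P)) ret ⟩
    iter σ (k ℕ.* P) w             ≡⟨ iter-multiple σ ret k ⟩
    w                              ∎
    where open ≡-Reasoning

  iter-mod : ∀ σ {P w} .{{_ : NonZero P}} → iter σ P w ≡ w → ∀ t → iter σ t w ≡ iter σ (t % P) w
  iter-mod σ {P} {w} ret t = begin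
    iter σ t w                                  ≡⟨ cong (λ k → iter σ k w) (trans (m≡m%n+[m/n]*n t P) (ℕₚ.+-comm (t % P) _)) ⟩
    iter σ ((t / P) ℕ.* P ℕ.+ t % P) w          ≡⟨ iter-+ σ ((t / P) ℕ.* P) (t % P) w ⟩
    iter σ (t % P) (iter σ ((t / P) ℕ.* P) w)   ≡⟨ cong (iter σ (t % P)) (iter-multiple σ ret (t / P)) ⟩
    iter σ (t % P) w                            ∎
    where open ≡-Reasoning

  CycleAt : Policy → Fin n → Subset m → Set
  CycleAt σ u C = (∃ λ k → iter σ (suc k) u ≡ u) ×ₚ (∀ b → (b ∈ C) ⇔ (∃ λ i → b ≡ σ (iter σ i u)))

  -- A cycle can be based at any of its states: the states are those s with σ(s) ∈ C.
  cycleAt-rebase : ∀ {σ u C s} → IsPolicy σ → CycleAt σ u C → σ s ∈ C → CycleAt σ s C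
  cycleAt-rebase {σ} {u} {C} {s} policy ((k , ret) , members) σs∈C =
    (k , s-returns) , λ b → mk⇔ (from-u b) (to-u b)
    where
      e : ℕ
      e = proj₁ (Equivalence.to (members (σ s)) σs∈C)
      s≡iter : s ≡ iter σ e u
      s≡iter = begin
        s                    ≡⟨ sym (policy s) ⟩
        src (σ s)            ≡⟨ cong src (proj₂ (Equivalence.to (members (σ s)) σs∈C)) ⟩
        src (σ (iter σ e u)) ≡⟨ policy (iter σ e u) ⟩
        iter σ e u           ∎
        where open ≡-Reasoning
      -- from s = iter σ e u, another k·e steps complete e laps of length k + 1
      around : ∀ i → iter σ (k ℕ.* e ℕ.+ i) s ≡ iter σ i u
      around i = begin
        iter σ (k ℕ.* e ℕ.+ i) s              ≡⟨ cong (iter σ (k ℕ.* e ℕ.+ i)) s≡iter ⟩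
        iter σ (k ℕ.* e ℕ.+ i) (iter σ e u)   ≡⟨ sym (iter-+ σ e (k ℕ.* e ℕ.+ i) u) ⟩
        iter σ (e ℕ.+ (k ℕ.* e ℕ.+ i)) u      ≡⟨ cong (λ t → iter σ t u) (sym (ℕₚ.+-assoc e (k ℕ.* e) i)) ⟩
        iter σ (suc k ℕ.* e ℕ.+ i) u          ≡⟨ iter-+ σ (suc k ℕ.* e) i u ⟩
        iter σ i (iter σ (suc k ℕ.* e) u)     ≡⟨ cong (λ t → iter σ i (iter σ t u)) (ℕₚ.*-comm (suc k) e) ⟩
        iter σ i (iter σ (e ℕ.* suc k) u)     ≡⟨ cong (iter σ i) (iter-multiple σ ret e) ⟩
        iter σ i u                            ∎
        where open ≡-Reasoning
      s-returns : iter σ (suc k) s ≡ s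
      s-returns = begin
        iter σ (suc k) s               ≡⟨ cong (iter σ (suc k)) s≡iter ⟩
        iter σ (suc k) (iter σ e u)    ≡⟨ sym (iter-+ σ e (suc k) u) ⟩
        iter σ (e ℕ.+ suc k) u         ≡⟨ cong (λ t → iter σ t u) (ℕₚ.+-comm e (suc k)) ⟩
        iter σ (suc k ℕ.+ e) u         ≡⟨ iter-+ σ (suc k) e u ⟩
        iter σ e (iter σ (suc k) u)    ≡⟨ cong (iter σ e) ret ⟩
        iter σ e u                     ≡⟨ sym s≡iter ⟩
        s                              ∎
        where open ≡-Reasoning
      from-u : ∀ b → b ∈ C → ∃ λ i → b ≡ σ (iter σ i s)
      from-u b b∈C with Equivalence.to (members b) b∈C
      ... | i , b≡ = k ℕ.* e ℕ.+ i , trans b≡ (cong σ (sym (around i)))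
      to-u : ∀ b → (∃ λ i → b ≡ σ (iter σ i s)) → b ∈ C
      to-u b (i , b≡) = Equivalence.from (members b)
        (e ℕ.+ i , trans b≡ (cong σ (trans (cong (iter σ i) s≡iter) (sym (iter-+ σ e i u)))))

  FirstReturn : Policy → Fin n → ℕ → Set
  FirstReturn σ w P = iter σ P w ≡ w ×ₚ (∀ t → 0 <ℕ t → t <ℕ P → ¬ (iter σ t w ≡ w))

  firstReturn : ∀ σ {w} q → iter σ (suc q) w ≡ w → ∃ λ p → FirstReturn σ w (suc p)
  firstReturn σ {w} q = search q (<-wellFounded q)
    where
      search : ∀ q → Acc _<ℕ_ q → iter σ (suc q) w ≡ w → ∃ λ p → FirstReturn σ w (suc p)
      search q (acc smaller) ret with any? (λ (x : Fin q) → iter σ (suc (toℕ x)) w ≟ w)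
      ... | yes (x , ret′) = search (toℕ x) (smaller (toℕ<n x)) ret′
      ... | no none        = q , ret , minimal
        where
          minimal : ∀ t → 0 <ℕ t → t <ℕ suc q → ¬ (iter σ t w ≡ w)
          minimal (suc t) _ (s≤s t<q) ret′ =
            none (fromℕ< t<q , subst (λ k → iter σ (suc k) w ≡ w) (sym (toℕ-fromℕ< t<q)) ret′)

  firstReturn≤n : ∀ σ {w P} → FirstReturn σ w P → P ≤ℕ n
  firstReturn≤n σ {w} {P} (ret , minimal) = ℕₚ.≮⇒≥ λ n<P → repeat (pigeonhole n<P (λ x → iter σ (toℕ x) w))
    where
      repeat : (∃₂ λ i j → i Fin.< j ×ₚ iter σ (toℕ i) w ≡ iter σ (toℕ j) w) → ⊥
      repeat (i , j , i<j , same) = minimal (toℕ i ℕ.+ (P ∸ toℕ j)) positive shorter returns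
        where
          j≤P : toℕ j ≤ℕ P
          j≤P = ℕₚ.<⇒≤ (toℕ<n j)
          positive : 0 <ℕ toℕ i ℕ.+ (P ∸ toℕ j)
          positive = ℕₚ.<-≤-trans (ℕₚ.m<n⇒0<n∸m (toℕ<n j)) (ℕₚ.m≤n+m (P ∸ toℕ j) (toℕ i))
          shorter : toℕ i ℕ.+ (P ∸ toℕ j) <ℕ P
          shorter = subst (toℕ i ℕ.+ (P ∸ toℕ j) <ℕ_) (ℕₚ.m+[n∸m]≡n j≤P) (ℕₚ.+-monoˡ-< (P ∸ toℕ j) i<j)
          returns : iter σ (toℕ i ℕ.+ (P ∸ toℕ j)) w ≡ w
          returns = begin
            iter σ (toℕ i ℕ.+ (P ∸ toℕ j)) w              ≡⟨ iter-+ σ (toℕ i) (P ∸ toℕ j) w ⟩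
            iter σ (P ∸ toℕ j) (iter σ (toℕ i) w)         ≡⟨ cong (iter σ (P ∸ toℕ j)) same ⟩
            iter σ (P ∸ toℕ j) (iter σ (toℕ j) w)         ≡⟨ sym (iter-+ σ (toℕ j) (P ∸ toℕ j) w) ⟩
            iter σ (toℕ j ℕ.+ (P ∸ toℕ j)) w              ≡⟨ cong (λ t → iter σ t w) (ℕₚ.m+[n∸m]≡n j≤P) ⟩
            iter σ P w                                    ≡⟨ ret ⟩
            w                                             ∎
            where open ≡-Reasoning

module Discounting (F : OrderedField) {n : ℕ} (M : DMDP F n) where
  open OrderedField F
  open OrderedFieldProperties F
  open FieldSolver F using (solve; _:=_; _:+_; _:*_; _:-_; :0; :1)
  open DMDP M
  open MDPNotions F M
  open FunctionalGraph F M

  γ-unit-interval : ∀ b → 0# ≤ γ b ×ₚ γ b ≤ 1#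
  γ-unit-interval b = proj₁ (γ-range b) , proj₁ (proj₂ (γ-range b))

  discount : Policy → ℕ → Fin n → Carrier
  discount σ zero    w = 1#
  discount σ (suc t) w = γ (σ w) * discount σ t (tgt (σ w))

  discount-unit-interval : ∀ σ t w → 0# ≤ discount σ t w ×ₚ discount σ t w ≤ 1#
  discount-unit-interval σ zero    w = 0≤1 , ≤-refl
  discount-unit-interval σ (suc t) w with γ-unit-interval (σ w) | discount-unit-interval σ t (tgt (σ w))
  ... | 0≤γ , γ≤1 | 0≤D , D≤1 =
    *-nonneg _ _ 0≤γ 0≤D , ≤-trans (*-monoˡ-≤ _ 0≤γ D≤1) (≤-respect (solve 1 (λ x → x := x :* :1) refl _) refl γ≤1)

  discount≤step : ∀ σ {t p} w → t <ℕ p → discount σ p w ≤ γ (σ (iter σ t w))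
  discount≤step σ {zero} {suc p} w _ with γ-unit-interval (σ w) | discount-unit-interval σ p (tgt (σ w))
  ... | 0≤γ , _ | _ , D≤1 = ≤-respect refl (solve 1 (λ x → x :* :1 := x) refl _) (*-monoˡ-≤ _ 0≤γ D≤1)
  discount≤step σ {suc t} {suc p} w (s≤s t<p) with γ-unit-interval (σ w) | discount-unit-interval σ p (tgt (σ w))
  ... | _ , γ≤1 | 0≤D , _ =
    ≤-trans (≤-respect refl (solve 1 (λ x → :1 :* x := x) refl _) (*-monoʳ-≤ _ 0≤D γ≤1))
            (discount≤step σ (tgt (σ w)) t<p)

  power≤discount : ∀ σ {c} → 0# ≤ c → c ≤ 1# → ∀ p w → (∀ t → c ≤ γ (σ (iter σ t w))) → c ^ p ≤ discount σ p w
  power≤discount σ 0≤c c≤1 zero    w c≤γ = ≤-refl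
  power≤discount σ 0≤c c≤1 (suc p) w c≤γ =
    ≤-trans (*-monoʳ-≤ _ (proj₁ (^-unit-interval 0≤c c≤1 p)) (c≤γ 0))
            (*-monoˡ-≤ _ (proj₁ (γ-unit-interval (σ w))) (power≤discount σ 0≤c c≤1 p (tgt (σ w)) (λ t → c≤γ (suc t))))

  Accumulates : Policy → (Fin n → Carrier) → (Fin n → Carrier) → Set
  Accumulates σ G d = ∀ w → d w ≡ G w + γ (σ w) * d (tgt (σ w))

  value-difference-accumulates : ∀ {σ vσ} v → IsPolicy σ → IsValue σ vσ →
    Accumulates σ (λ w → gain v (σ w)) (λ w → vσ w - v w)
  value-difference-accumulates {σ} {vσ} v policy value w = begin
    vσ w - v w                                        ≡⟨ cong (_- v w) (value w) ⟩
    r (σ w) + γ (σ w) * vσ (tgt (σ w)) - v w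
      ≡⟨ solve 5 (λ R G X Y V → R :+ G :* X :- V := (R :+ G :* Y :- V) :+ G :* (X :- Y)) refl
               (r (σ w)) (γ (σ w)) (vσ (tgt (σ w))) (v (tgt (σ w))) (v w) ⟩
    r (σ w) + γ (σ w) * v (tgt (σ w)) - v w + γ (σ w) * (vσ (tgt (σ w)) - v (tgt (σ w)))
      ≡⟨ cong (λ u → r (σ w) + γ (σ w) * v (tgt (σ w)) - v u + γ (σ w) * (vσ (tgt (σ w)) - v (tgt (σ w))))
              (sym (policy w)) ⟩
    gain v (σ w) + γ (σ w) * (vσ (tgt (σ w)) - v (tgt (σ w)))  ∎
    where open ≡-Reasoning

  gain-own-action : ∀ {π v} → IsPolicy π → IsValue π v → ∀ w → gain v (π w) ≡ 0#
  gain-own-action {π} {v} policy value w = begin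
    r (π w) + γ (π w) * v (tgt (π w)) - v (src (π w))  ≡⟨ cong (λ u → r (π w) + γ (π w) * v (tgt (π w)) - v u) (policy w) ⟩
    r (π w) + γ (π w) * v (tgt (π w)) - v w            ≡⟨ cong (λ x → r (π w) + γ (π w) * v (tgt (π w)) - x) (value w) ⟩
    r (π w) + γ (π w) * v (tgt (π w)) - (r (π w) + γ (π w) * v (tgt (π w)))  ≡⟨ solve 1 (λ x → x :- x := :0) refl _ ⟩
    0#                                                  ∎
    where open ≡-Reasoning

  unroll-≤ : ∀ {σ G d Δ} → Accumulates σ G d → (∀ w → G w ≤ Δ) → 0# ≤ Δ →
    ∀ t w → d w ≤ fromℕ t * Δ + discount σ t w * d (iter σ t w)
  unroll-≤ {σ} {G} {d} {Δ} accum G≤Δ 0≤Δ zero w =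
    ≤-reflexive (solve 2 (λ D Δ → D := :0 :* Δ :+ :1 :* D) refl (d w) Δ)
  unroll-≤ {σ} {G} {d} {Δ} accum G≤Δ 0≤Δ (suc t) w =
    ≤-respect (sym (accum w))
      (solve 5 (λ Δ g T P D → Δ :+ (T :* Δ :+ g :* P :* D) := (:1 :+ T) :* Δ :+ g :* P :* D) refl
             Δ (γ (σ w)) (fromℕ t) (discount σ t w′) (d (iter σ t w′)))
      (+-mono₂-≤ (G≤Δ w) rest)
    where
      w′ : Fin n
      w′ = tgt (σ w)
      rest : γ (σ w) * d w′ ≤ fromℕ t * Δ + γ (σ w) * discount σ t w′ * d (iter σ t w′)
      rest with γ-unit-interval (σ w)
      ... | 0≤γ , γ≤1 =
        ≤-trans (*-monoˡ-≤ _ 0≤γ (unroll-≤ accum G≤Δ 0≤Δ t w′))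
          (≤-respect (solve 4 (λ g T P D → g :* T :+ g :* P :* D := g :* (T :+ P :* D)) refl
                               (γ (σ w)) (fromℕ t * Δ) (discount σ t w′) (d (iter σ t w′)))
                     refl
            (+-mono-≤ _ _ _ (≤-respect refl (solve 1 (λ x → :1 :* x := x) refl _)
              (*-monoʳ-≤ _ (*-nonneg _ _ (fromℕ-nonneg t) 0≤Δ) γ≤1))))

  unroll-≡ : ∀ {σ G d} → Accumulates σ G d → ∀ t w → (∀ q → q <ℕ t → G (iter σ q w) ≡ 0#) →
    d w ≡ discount σ t w * d (iter σ t w)
  unroll-≡ {σ} {G} {d} accum zero    w _ = solve 1 (λ D → D := :1 :* D) refl (d w)
  unroll-≡ {σ} {G} {d} accum (suc t) w G≡0 = begin
    d w                                               ≡⟨ accum w ⟩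
    G w + γ (σ w) * d (tgt (σ w))                     ≡⟨ cong₂ (λ g x → g + γ (σ w) * x) (G≡0 0 (s≤s z≤n))
                                                           (unroll-≡ accum t (tgt (σ w)) (λ q q<t → G≡0 (suc q) (s≤s q<t))) ⟩
    0# + γ (σ w) * (discount σ t (tgt (σ w)) * d (iter σ t (tgt (σ w))))
      ≡⟨ solve 3 (λ g P D → :0 :+ g :* (P :* D) := g :* P :* D) refl _ _ _ ⟩
    discount σ (suc t) w * d (iter σ (suc t) w)       ∎
    where open ≡-Reasoning

module Estimates (F : OrderedField) where
  open OrderedField F
  open OrderedFieldProperties F
  open FieldSolver F using (solve; _:=_; _:+_; _:*_; _:-_; :0; :1)
  open CommutativeRing (FieldSolver.commutativeRing F) using (*-comm; *-assoc)

  fixed-point-bounds : ∀ {c Δ Q y q k} → 0# ≤ c → c ≤ 1# → 0# < Δ →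
    y ≡ Δ + Q * y → c ^ q ≤ Q → Q ≤ 1# → q ≤ℕ k →
    0# ≤ y ×ₚ Δ ≤ fromℕ k * (1# - c) * y
  fixed-point-bounds {c} {Δ} {Q} {y} {q} {k} 0≤c c≤1 (0≤Δ , 0≢Δ) y≡ cᵠ≤Q Q≤1 q≤k = 0≤y , Δ≤
    where
      Δ≡ : Δ ≡ (1# - Q) * y
      Δ≡ = begin
        Δ                ≡⟨ solve 3 (λ D Q Y → D := D :+ Q :* Y :- Q :* Y) refl Δ Q y ⟩
        Δ + Q * y - Q * y ≡⟨ cong (_- Q * y) (sym y≡) ⟩
        y - Q * y        ≡⟨ solve 2 (λ Q Y → Y :- Q :* Y := (:1 :- Q) :* Y) refl Q y ⟩
        (1# - Q) * y     ∎
        where open ≡-Reasoning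
      0≤y : 0# ≤ y
      0≤y with total 0# y
      ... | inj₁ 0≤y = 0≤y
      ... | inj₂ y≤0 = ⊥-elim (0≢Δ (antisym 0≤Δ
                         (≤-respect (sym Δ≡) refl (*-nonneg-nonpos (difference-nonneg Q≤1) y≤0))))
      Δ≤ : Δ ≤ fromℕ k * (1# - c) * y
      Δ≤ = ≤-respect (sym Δ≡) refl (*-monoʳ-≤ y 0≤y (begin
        1# - Q                   ≤⟨ +-monoʳ-≤ 1# (neg-antitone cᵠ≤Q) ⟩
        1# - c ^ q               ≤⟨ bernoulli 0≤c c≤1 q ⟩
        fromℕ q * (1# - c)       ≤⟨ *-monoʳ-≤ _ (difference-nonneg c≤1) (fromℕ-mono q≤k) ⟩
        fromℕ k * (1# - c)       ∎))
        where open ≤-Reasoning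

  subfixed-point-bound : ∀ {c Δ P x p k} → 0# ≤ Δ → x ≤ fromℕ p * Δ + P * x → P ≤ c → p ≤ℕ k →
    0# ≤ x → (1# - c) * x ≤ fromℕ k * Δ
  subfixed-point-bound {c} {Δ} {P} {x} {p} {k} 0≤Δ x≤ P≤c p≤k 0≤x = begin
    (1# - c) * x      ≤⟨ *-monoʳ-≤ x 0≤x (+-monoʳ-≤ 1# (neg-antitone P≤c)) ⟩
    (1# - P) * x      ≤⟨ ≤-by-difference (fromℕ p * Δ + P * x - x)
                           (solve 3 (λ A P X → A :+ P :* X :- X := A :- (:1 :- P) :* X) refl (fromℕ p * Δ) P x)
                           (difference-nonneg x≤) ⟩
    fromℕ p * Δ       ≤⟨ *-monoʳ-≤ Δ 0≤Δ (fromℕ-mono p≤k) ⟩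
    fromℕ k * Δ       ∎
    where open ≤-Reasoning

  contraction : ∀ k .{{_ : NonZero k}} {c Δ x y} → c < 1# → 0# ≤ y → Δ ≤ fromℕ k * (1# - c) * y →
    (0# ≤ x → (1# - c) * x ≤ fromℕ k * Δ) →
    x - y ≤ (1# - (fromℕ (k *ℕ k)) ⁻¹) * x
  contraction (suc k) {c} {Δ} {x} {y} (c≤1 , c≢1) 0≤y Δ≤ x-bound =
    ≤-by-difference (y - N ⁻¹ * x)
      (solve 3 (λ x y i → y :- i :* x := (:1 :- i) :* x :- (x :- y)) refl x y (N ⁻¹))
      (difference-nonneg N⁻¹x≤y)
    where
      K N : Carrier
      K = fromℕ (suc k)
      N = fromℕ (suc k ℕ.* suc k)
      N≢0 : ¬ (N ≡ 0#)
      N≢0 = fromℕ-suc-nonzero (k ℕ.+ k ℕ.* suc k)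
      0≤N⁻¹ : 0# ≤ N ⁻¹
      0≤N⁻¹ = ⁻¹-nonneg (fromℕ-nonneg (suc k ℕ.* suc k)) N≢0
      0<1-c : 0# < 1# - c
      0<1-c = difference-nonneg c≤1 , λ 0≡1-c → c≢1 (begin
        c                ≡⟨ solve 1 (λ c → c := :1 :- (:1 :- c)) refl c ⟩
        1# - (1# - c)    ≡⟨ cong (λ z → 1# - z) (sym 0≡1-c) ⟩
        1# - 0#          ≡⟨ solve 0 (:1 :- :0 := :1) refl ⟩
        1#               ∎)
        where open ≡-Reasoning
      x≤Ny : 0# ≤ x → x ≤ N * y
      x≤Ny 0≤x = ≤-by-difference (N * y - x) refl (*-cancelˡ-nonneg 0<1-c (≤-respect refl
        (trans (solve 4 (λ K c y x → K :* (K :* (:1 :- c) :* y) :- (:1 :- c) :* x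
                                     := (:1 :- c) :* (K :* K :* y :- x)) refl K c y x)
               (cong (λ z → (1# - c) * (z * y - x)) (sym (fromℕ-* (suc k) (suc k)))))
        (difference-nonneg (≤-trans (x-bound 0≤x) (*-monoˡ-≤ K (fromℕ-nonneg (suc k)) Δ≤)))))
      N⁻¹x≤y : N ⁻¹ * x ≤ y
      N⁻¹x≤y with total 0# x
      ... | inj₂ x≤0 = ≤-trans (*-nonneg-nonpos 0≤N⁻¹ x≤0) 0≤y
      ... | inj₁ 0≤x = ≤-respect refl
        (trans (sym (*-assoc (N ⁻¹) N y)) (trans (cong (_* y) (trans (*-comm (N ⁻¹) N) (⁻¹-inverse N N≢0)))
          (solve 1 (λ y → :1 :* y := y) refl y)))
        (*-monoˡ-≤ (N ⁻¹) 0≤N⁻¹ (x≤Ny 0≤x))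

module PivotCycles (F : OrderedField) {n : ℕ} (M : DMDP F n) where
  open DMDP M
  open MDPNotions F M
  open FunctionalGraph F M

  pivot-orbit-agrees : ∀ {π b π′} → Pivot π b π′ → ∀ u → (∀ t → ¬ (iter π′ t u ≡ src b)) →
    ∀ t → iter π t u ≡ iter π′ t u
  pivot-orbit-agrees         pivot u avoids zero    = refl
  pivot-orbit-agrees {π} {b} {π′} pivot u avoids (suc t) = begin
    iter π t (tgt (π u))      ≡⟨ cong (λ a → iter π t (tgt a)) (sym (proj₂ pivot u (avoids 0))) ⟩
    iter π t (tgt (π′ u))     ≡⟨ pivot-orbit-agrees pivot (tgt (π′ u)) (λ t → avoids (suc t)) t ⟩
    iter π′ t (tgt (π′ u))    ∎
    where open ≡-Reasoning

  -- A cycle created by a pivot contains the entering action: otherwise the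
  -- cycle avoids the pivoting state and was already a cycle before the pivot.
  new-cycle-contains-pivot : ∀ {π b π′ C} → Pivot π b π′ → IsCycle π′ C → ¬ IsCycle π C → b ∈ C
  new-cycle-contains-pivot {π} {b} {π′} {C} pivot (u , (k , ret) , members) not-old with b ∈? C
  ... | yes b∈C = b∈C
  ... | no  b∉C = ⊥-elim (not-old (u , (k , trans (agrees (suc k)) ret) , λ b′ → mk⇔
          (λ b′∈C → let (t , b′≡) = Equivalence.to (members b′) b′∈C in t , trans b′≡ (sym (same-action t)))
          (λ (t , b′≡) → Equivalence.from (members b′) (t , trans b′≡ (same-action t)))))
    where
      avoids : ∀ t → ¬ (iter π′ t u ≡ src b)
      avoids t on-s = b∉C (Equivalence.from (members b)
        (t , trans (sym (proj₁ pivot)) (cong π′ (sym on-s))))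
      agrees : ∀ t → iter π t u ≡ iter π′ t u
      agrees = pivot-orbit-agrees pivot u avoids
      same-action : ∀ t → π (iter π t u) ≡ π′ (iter π′ t u)
      same-action t = trans (cong π (agrees t)) (sym (proj₂ pivot (iter π′ t u) (avoids t)))

module HighestGainStep (F : OrderedField) {n : ℕ} (M : DMDP F n)
                       (R : MDPNotions.HGRun F M) (i : ℕ) (i<K : i <ℕ MDPNotions.HGRun.K R) where
  open OrderedField F
  open OrderedFieldProperties F
  open DMDP M
  open MDPNotions F M
  open HGRun R
  open FunctionalGraph F M
  open Discounting F M
  open PivotCycles F M
  open CommutativeRing (FieldSolver.commutativeRing F) using (*-assoc)

  s : Fin n
  s = src (piv i)

  Δ : Carrier
  Δ = gain (val i) (piv i)

  relative : ℕ → Carrier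
  relative j = val j s - val i s

  relative-accumulates : ∀ j → Accumulates (pol j) (λ w → gain (val i) (pol j w)) (λ w → val j w - val i w)
  relative-accumulates j = value-difference-accumulates (val i) (pol-ok j) (val-ok j)

  -- The new cycle goes around s; along it, only the entering action has nonzero
  -- gain, so y = relative (i + 1) satisfies y = Δ + Q y where Q, the product of
  -- the discounts around the cycle, lies between γ_a^q (q ≤ n the cycle length) and 1.
  new-cycle-fixed-point : ∀ {C a} → IsCycle (pol (suc i)) C → ¬ IsCycle (pol i) C → DominatedBy C a →
    ∃₂ λ q Q → q ≤ℕ n ×ₚ relative (suc i) ≡ Δ + Q * relative (suc i) ×ₚ γ a ^ q ≤ Q ×ₚ Q ≤ 1#
  new-cycle-fixed-point {C} {a} cycle not-old (_ , γa≤) =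
    suc p , discount π′ (suc p) s , firstReturn≤n π′ first , fixed-point
    , power≤discount π′ (proj₁ (γ-unit-interval a)) (proj₂ (γ-unit-interval a)) (suc p) s γa≤cycle
    , proj₂ (discount-unit-interval π′ (suc p) s)
    where
      π′ : Policy
      π′ = pol (suc i)
      pivot : Pivot (pol i) (piv i) π′
      pivot = piv-upd i i<K
      π′s≡b : π′ s ≡ piv i
      π′s≡b = proj₁ pivot
      at-s : CycleAt π′ s C
      at-s = cycleAt-rebase (pol-ok (suc i)) (proj₂ cycle)
               (subst (_∈ C) (sym π′s≡b) (new-cycle-contains-pivot pivot cycle not-old))
      first-return : ∃ λ p → FirstReturn π′ s (suc p)
      first-return = firstReturn π′ (proj₁ (proj₁ at-s)) (proj₂ (proj₁ at-s))
      p : ℕ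
      p = proj₁ first-return
      first : FirstReturn π′ s (suc p)
      first = proj₂ first-return
      γa≤cycle : ∀ t → γ a ≤ γ (π′ (iter π′ t s))
      γa≤cycle t = γa≤ _ (Equivalence.from (proj₂ at-s (π′ (iter π′ t s))) (t , refl))
      d : Fin n → Carrier
      d w = val (suc i) w - val i w
      zero-gain-off-s : ∀ w → ¬ (w ≡ s) → gain (val i) (π′ w) ≡ 0#
      zero-gain-off-s w w≢s = trans (cong (gain (val i)) (proj₂ pivot w w≢s)) (gain-own-action (pol-ok i) (val-ok i) w)
      after-b : Fin n
      after-b = tgt (π′ s)
      fixed-point : d s ≡ Δ + discount π′ (suc p) s * d s
      fixed-point = begin
        d s                                            ≡⟨ relative-accumulates (suc i) s ⟩
        gain (val i) (π′ s) + γ (π′ s) * d after-b     ≡⟨ cong₂ (λ g x → g + γ (π′ s) * x) (cong (gain (val i)) π′s≡b)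
                                                          (unroll-≡ (relative-accumulates (suc i)) p after-b
                                                            (λ q q<p → zero-gain-off-s _ (proj₂ first (suc q) (s≤s z≤n) (s≤s q<p)))) ⟩
        Δ + γ (π′ s) * (discount π′ p after-b * d (iter π′ (suc p) s))
                                                       ≡⟨ cong (λ w → Δ + γ (π′ s) * (discount π′ p after-b * d w)) (proj₁ first) ⟩
        Δ + γ (π′ s) * (discount π′ p after-b * d s)   ≡⟨ cong (Δ +_) (sym (*-assoc _ _ _)) ⟩
        Δ + discount π′ (suc p) s * d s                ∎
        where open ≡-Reasoning

  -- Along a cycle of π_j through s dominated by γ_a every gain is at most Δ, and
  -- the product P of its discounts is at most γ_a; so x = relative j satisfies
  -- x ≤ p Δ + P x with p ≤ n the cycle length.
  dominated-cycle-subfixed-point : ∀ {j a} → OnDominatedCycle (pol j) s a →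
    ∃₂ λ p P → p ≤ℕ n ×ₚ relative j ≤ fromℕ p * Δ + P * relative j ×ₚ P ≤ γ a
  dominated-cycle-subfixed-point {j} {a} (C , (u , cycle) , πs∈C , ((b , b∈C , γb≡γa) , _)) =
    suc p , discount π (suc p) s , firstReturn≤n π first , subfixed-point , discount≤γa
    where
      π : Policy
      π = pol j
      at-s : CycleAt π s C
      at-s = cycleAt-rebase (pol-ok j) cycle πs∈C
      first-return : ∃ λ p → FirstReturn π s (suc p)
      first-return = firstReturn π (proj₁ (proj₁ at-s)) (proj₂ (proj₁ at-s))
      p : ℕ
      p = proj₁ first-return
      first : FirstReturn π s (suc p)
      first = proj₂ first-return
      e : ℕ
      e = proj₁ (Equivalence.to (proj₂ at-s b) b∈C)
      subfixed-point : relative j ≤ fromℕ (suc p) * Δ + discount π (suc p) s * relative j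
      subfixed-point = ≤-respect refl (cong (λ w → fromℕ (suc p) * Δ + discount π (suc p) s * (val j w - val i w)) (proj₁ first))
        (unroll-≤ (relative-accumulates j) (λ w → piv-max i i<K (π w)) (proj₁ (piv-pos i i<K)) (suc p) s)
      discount≤γa : discount π (suc p) s ≤ γ a
      discount≤γa = ≤-respect refl
        (trans (cong (λ w → γ (π w)) (sym (iter-mod π (proj₁ first) e)))
               (trans (cong γ (sym (proj₂ (Equivalence.to (proj₂ at-s b) b∈C)))) γb≡γa))
        (discount≤step π s (m%n<n e (suc p)))


lemma4p5 : (F : OrderedField) → let open OrderedField F in
    {n : ℕ} (M : DMDP F n) → let open DMDP M in let open MDPNotions F M in
    (R : HGRun) → let open HGRun R in
    (i : ℕ) → i <ℕ K →
    (C : Subset m) (a : Fin m) →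
    IsCycle (pol (suc i)) C → ¬ IsCycle (pol i) C →
    IsActionOf (pol (suc i)) a → DominatedBy C a →
    (j : ℕ) → j ≤ℕ K → OnDominatedCycle (pol j) (src (piv i)) a →
    (∀ k → j <ℕ k → k ≤ℕ K → ¬ OnDominatedCycle (pol k) (src (piv i)) a) →
    val j (src (piv i)) - val (suc i) (src (piv i))
      ≤ (1# - (fromℕ (n *ℕ n)) ⁻¹) * (val j (src (piv i)) - val i (src (piv i)))
-- Steps (1)-(3) of the plan; regrouping turns x - y into v″(s) - v′(s).
lemma4p5 F {n} M R i i<K C a new not-old _ dominated j _ on-cycle _ =
  let q , Q , q≤n , y≡ , cᵠ≤Q , Q≤1 = new-cycle-fixed-point new not-old dominated
      p , P , p≤n , x≤ , P≤c        = dominated-cycle-subfixed-point on-cycle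
      0≤y , Δ≤                      = fixed-point-bounds 0≤c c≤1 (piv-pos i i<K) y≡ cᵠ≤Q Q≤1 q≤n
  in ≤-respect (solve 3 (λ x y z → (x :- z) :- (y :- z) := x :- y) refl (val j s) (val (suc i) s) (val i s)) refl
       (contraction n {{n-nonzero}} c<1 0≤y Δ≤ (subfixed-point-bound (proj₁ (piv-pos i i<K)) x≤ P≤c p≤n))
  where
    open OrderedField F
    open OrderedFieldProperties F
    open FieldSolver F using (solve; _:=_; _:-_)
    open Estimates F
    open DMDP M
    open MDPNotions.HGRun R
    open HighestGainStep F M R i i<K
    n-nonzero : NonZero n
    n-nonzero = nonzero-of s
      where
        nonzero-of : ∀ {k} → Fin k → NonZero k
        nonzero-of {suc k} _ = _
    0≤c : 0# ≤ γ a
    0≤c = proj₁ (γ-range a)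
    c≤1 : γ a ≤ 1#
    c≤1 = proj₁ (proj₂ (γ-range a))
    c<1 : γ a < 1#
    c<1 = proj₂ (γ-range a)
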